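{- \[ 3=\sqrt{1^2+(5+1^2-4)\sqrt{3^2+(5+2^2-8)\sqrt{\cdots\sqrt{(2n-1)^2+(5+n^2-4n)\sqrt{\cdots}}}}}, \] i.e. the infinitely nested radical whose $n$-th level ($n=1,2,\dots$) is $\sqrt{(2n-1)^2+(n^2-4n+5)\sqrt{\cdots}}$ equals $3$.
   Context: The right-hand side is an infinitely nested radical; the paper obtains this equality in the same formal sense as its general nested-radical identities. -}

module Defs where

open import Data.Nat using (ℕ; suc; _+_; _*_; _∸_; _≤_)
open import Data.Product using (Σ; _×_)
open import Relation.Binary.PropositionalEquality using (_≡_)

-- n-th level of the radical:  sqrt( a n + b n * sqrt( level (n+1) ... ) )
-- a n = (2n-1)^2 ,  b n = n^2 - 4n + 5  (always ≥ 1, so truncated ∸ is exact)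
a : ℕ → ℕ
a n = (2 * n ∸ 1) * (2 * n ∸ 1)

b : ℕ → ℕ
b n = (n * n + 5) ∸ (4 * n)

-- Formal (Ramanujan-style) meaning of
--   x = sqrt(a 1 + b 1 sqrt(a 2 + b 2 sqrt(...))):
-- there is a nonnegative sequence of level values f with f 1 = x and
-- f n = sqrt(a n + b n * f (n+1)), i.e. f n ^ 2 = a n + b n * f (n+1), f n ≥ 0.
NestedRadicalEquals : ℕ → Set
NestedRadicalEquals x =
  Σ (ℕ → ℕ) λ f → (f 1 ≡ x) × (∀ n → 1 ≤ n → f n * f n ≡ a n + b n * f (suc n))

module Submission where

open import Defs
open import Data.Nat
open import Data.Nat.Properties using (m+n∸n≡m)
open import Data.Nat.Tactic.RingSolver using (solve-∀)
open import Data.Product using (_,_)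
open import Relation.Binary.PropositionalEquality

-- The levels of the radical are f n = (n − 1)² + 3, so f 1 = 3.  Writing m = n − 1,
-- the recursion f n ² = a n + b n · f (n + 1) is the difference of squares
--   (m² + 3)² − (2m + 1)² = (m² − 2m + 2)(m² + 2m + 4),
-- whose two factors are exactly b n and f (n + 1).

level : ℕ → ℕ
level n = (n ∸ 1) * (n ∸ 1) + 3

m≡n+o⇒m∸o≡n : ∀ {m} n o → m ≡ n + o → m ∸ o ≡ n
m≡n+o⇒m∸o≡n n o refl = m+n∸n≡m n o

a-suc : ∀ m → a (suc m) ≡ (2 * m + 1) * (2 * m + 1)
a-suc m = cong (λ x → x * x) (m≡n+o⇒m∸o≡n (2 * m + 1) 1 (expand m))
  where
  expand : ∀ m → 2 * suc m ≡ (2 * m + 1) + 1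
  expand = solve-∀

b-suc-suc : ∀ k → b (suc (suc k)) ≡ k * k + 1
b-suc-suc k = m≡n+o⇒m∸o≡n (k * k + 1) (4 * (2 + k)) (expand k)
  where
  expand : ∀ k → (2 + k) * (2 + k) + 5 ≡ (k * k + 1) + 4 * (2 + k)
  expand = solve-∀

difference-of-squares : ∀ k →
  (suc k * suc k + 3) * (suc k * suc k + 3)
    ≡ (2 * suc k + 1) * (2 * suc k + 1) + (k * k + 1) * (suc (suc k) * suc (suc k) + 3)
difference-of-squares = solve-∀

level-step : ∀ n → 1 ≤ n → level n * level n ≡ a n + b n * level (suc n)
level-step 1 _ = refl
level-step (suc (suc k)) _ = begin
  level (2 + k) * level (2 + k)
    ≡⟨ difference-of-squares k ⟩
  (2 * suc k + 1) * (2 * suc k + 1) + (k * k + 1) * level (3 + k)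
    ≡⟨ sym (cong₂ (λ x y → x + y * level (3 + k)) (a-suc (suc k)) (b-suc-suc k)) ⟩
  a (2 + k) + b (2 + k) * level (3 + k)
    ∎
  where open ≡-Reasoning

corollary1 : NestedRadicalEquals 3
corollary1 = level , refl , level-step
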